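{- Consider a stable matching instance with one-sided uncertainty and a stable matching $M$. In the set query model, the minimum number of set queries needed to verify that $M$ is stable equals $|\{b \in B \mid \exists a \in A \colon b \prec_a M(a)\}|$, which is at most $n$. Further, there is a $1$-competitive algorithm to verify that $M$ is stable.
   Context: Two disjoint sets $A$, $B$ of agents with $|A|=|B|=n$. Each $a\in A$ has a strict total order $\prec_a$ on $B$ and each $b\in B$ has a strict total order $\prec_b$ on $A$; $x\prec_y z$ means $y$ prefers $x$ to $z$. A matching is a bijection between $A$ and $B$; it is stable if there is no pair $(a,b)$, $b\neq M(a)$, with $a$ preferring $b$ to $M(a)$ and $b$ preferring $a$ to $M(b)$. One-sided uncertainty: the orders $\prec_a$ ($a\in A$) are known, the orders $\prec_b$ ($b\in B$) are unknown and learned only via queries. A set query $\mathit{top}(b,S)$ for $b\in B$ and $S\subseteq A$ returns $b$'s most preferred element of $S$. A query set verifies stability if $M$ is stable for every $B$-side preference profile consistent with the answers. An algorithm is $\rho$-competitive if its number of queries is at most $\rho$ times this minimum; the ratio is measured only on inputs where $M$ is stable. -}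

module Defs where

open import Data.Nat using (ℕ)
open import Data.Fin using (Fin; _<_; _<?_)
open import Data.Fin.Properties using (any?)
open import Data.Fin.Subset using (Subset; _∈_)
open import Data.Fin.Permutation using (Permutation′; _⟨$⟩ʳ_; _⟨$⟩ˡ_)
open import Data.List using (List; []; _∷_; _∷ʳ_; filter; allFin; length; map)
open import Data.List.Relation.Unary.All using (All)
open import Data.Maybe using (Maybe; just; nothing)
open import Data.Product using (_×_; _,_; ∃; proj₁)
open import Data.Sum using (_⊎_)
open import Relation.Binary.PropositionalEquality using (_≡_; _≢_)
open import Relation.Nullary using (¬_; Dec)

-- A strict total order on Fin n, encoded as a ranking bijection:
-- rank 0 is the most preferred element.
Pref : ℕ → Set
Pref n = Permutation′ n

_≺[_]_ : ∀ {n} → Fin n → Pref n → Fin n → Set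
x ≺[ p ] y = (p ⟨$⟩ʳ x) < (p ⟨$⟩ʳ y)

-- A perfect matching: bijection A → B (A = B = Fin n as index sets).
Matching : ℕ → Set
Matching n = Permutation′ n

-- Preference profiles: prefA a orders B, prefB b orders A.
Profile : ℕ → Set
Profile n = Fin n → Pref n

Stable : ∀ {n} → Profile n → Profile n → Matching n → Set
Stable pA pB M = ∀ a b → b ≢ (M ⟨$⟩ʳ a) →
  ¬ ((b ≺[ pA a ] (M ⟨$⟩ʳ a)) × (a ≺[ pB b ] (M ⟨$⟩ˡ b)))

-- A set query top(b, S): agent b ∈ B and S ⊆ A.
Query : ℕ → Set
Query n = Fin n × Subset n

IsTop : ∀ {n} → Pref n → Subset n → Fin n → Set
IsTop p S a = a ∈ S × (∀ a′ → a′ ∈ S → a′ ≡ a ⊎ a ≺[ p ] a′)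

Answers : ∀ {n} → Profile n → Query n → Fin n → Set
Answers pB (b , S) a = IsTop (pB b) S a

Consistent : ∀ {n} → Profile n → Profile n → List (Query n) → Set
Consistent pB pB′ Q = All (λ q → ∀ a → Answers pB q a → Answers pB′ q a) Q

Verifies : ∀ {n} → Profile n → Matching n → Profile n → List (Query n) → Set
Verifies pA M pB Q = ∀ pB′ → Consistent pB pB′ Q → Stable pA pB′ M

Cand : ∀ {n} → Profile n → Matching n → Fin n → Set
Cand {n} pA M b = ∃ λ (a : Fin n) → b ≺[ pA a ] (M ⟨$⟩ʳ a)

cand? : ∀ {n} (pA : Profile n) (M : Matching n) (b : Fin n) → Dec (Cand pA M b)
cand? pA M b = any? (λ a → (pA a ⟨$⟩ʳ b) <? (pA a ⟨$⟩ʳ (M ⟨$⟩ʳ a)))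

candCount : ∀ {n} → Profile n → Matching n → ℕ
candCount {n} pA M = length (filter (cand? pA M) (allFin n))

-- Adaptive deterministic algorithm: given the known data (A-preferences and M)
-- and the history of (query, answer) pairs so far, it either issues the next
-- query (just q) or stops (nothing).
Algorithm : Set
Algorithm = ∀ {n} → Profile n → Matching n → List (Query n × Fin n) → Maybe (Query n)

data Reachable (alg : Algorithm) {n} (pA : Profile n) (M : Matching n) (pB : Profile n)
     : List (Query n × Fin n) → Set where
  start : Reachable alg pA M pB []
  step  : ∀ {h q a} → Reachable alg pA M pB h → alg pA M h ≡ just q →
          Answers pB q a → Reachable alg pA M pB (h ∷ʳ (q , a))

Terminates : Algorithm → ∀ {n} → Profile n → Matching n → Profile n →
             List (Query n × Fin n) → Set
Terminates alg pA M pB h = Reachable alg pA M pB h × alg pA M h ≡ nothing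

queriesOf : ∀ {n} → List (Query n × Fin n) → List (Query n)
queriesOf = map proj₁

-- The query top(b, S_b), where S_b is the set of agents a with b ⪯_a M(a),
-- answers M⁻¹(b) exactly when b lies in no blocking pair.  A blocking pair
-- (a, b) needs b ≺_a M(a), so only candidates b can block, and asking
-- top(b, S_b) for each of them verifies stability.  Conversely, if some
-- candidate b (with b ≺_a M(a)) is never queried, then re-ranking b's
-- preferences to put a first is consistent with all answers and makes (a, b)
-- blocking; hence every verifying query set mentions every candidate, and
-- asking exactly the queries top(b, S_b) in a fixed order is optimal.
module Submission where

open import Defs
open import Data.Nat using (ℕ; _≤_)
open import Data.List using (List; length)
open import Data.Product using (_×_; ∃)
open import Relation.Binary.PropositionalEquality using (_≡_)

open import Data.Nat using (suc; z≤n; s≤s; z<s)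
open import Data.Nat.Properties using (≤-trans; ≤-reflexive)
open import Data.Fin using (Fin; zero; suc; _<?_)
open import Data.Fin.Properties using (_≟_; <-cmp; <-irrefl; <-asym)
open import Data.Fin.Subset using (Subset; _∈_)
open import Data.Fin.Permutation using (_⟨$⟩ʳ_; _⟨$⟩ˡ_; inverseˡ; inverseʳ; transpose)
open import Data.Vec using (tabulate)
open import Data.Vec.Properties using (lookup∘tabulate; lookup⇒[]=; []=⇒lookup)
open import Data.Vec.Functional using (updateAt)
open import Data.Vec.Functional.Properties using (updateAt-updates; updateAt-minimal)
open import Data.List using ([]; _∷_; _∷ʳ_; [_]; _++_; map; filter; allFin; drop; head)
open import Data.List.Properties using (length-map; length-filter; length-tabulate; ++-identityʳ; ++-assoc; drop-all)
open import Data.List.Relation.Unary.All using (All; _∷_; universal)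
import Data.List.Relation.Unary.All as All
open import Data.List.Relation.Unary.All.Properties using (map⁺; map⁻; ¬Any⇒All¬)
open import Data.List.Relation.Unary.Any using (here; there; any?)
open import Data.List.Membership.Propositional using () renaming (_∈_ to _∈ₗ_)
open import Data.List.Membership.Propositional.Properties using (∈-map⁺; ∈-filter⁺; ∈-filter⁻; ∈-allFin)
open import Data.List.Relation.Binary.Subset.Propositional using (_⊆_)
open import Data.List.Relation.Unary.AllPairs using (_∷_)
open import Data.List.Relation.Unary.Unique.Propositional using (Unique)
open import Data.List.Relation.Unary.Unique.Propositional.Properties using (filter⁺; allFin⁺)
open import Data.Maybe using (just)
open import Data.Product using (_,_; proj₁; proj₂; uncurry)
open import Data.Sum using (_⊎_; inj₁; inj₂)
open import Data.Empty using (⊥-elim)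
open import Function using (_∘_; const; id)
open import Function.Bundles using (Inverse)
open import Relation.Nullary using (¬_; yes; no; does; contradiction)
open import Relation.Nullary.Decidable using (dec-true; _⊎-dec_)
open import Level using (0ℓ)
open import Relation.Unary using (Pred; Decidable)
open import Relation.Binary.Definitions using (tri<; tri≈; tri>)
open import Relation.Binary.PropositionalEquality using (_≢_; refl; sym; trans; cong; subst)

private
  variable
    n : ℕ

∈-remove : ∀ {A : Set} {x : A} {ys : List A} → x ∈ₗ ys →
           ∃ λ ys′ → length ys ≡ suc (length ys′) × (∀ {z} → z ∈ₗ ys → z ≢ x → z ∈ₗ ys′)
∈-remove {ys = y ∷ ys} (here refl) =
  ys , refl , λ { (here z≡x) z≢x → contradiction z≡x z≢x ; (there z∈ys) _ → z∈ys }
∈-remove {ys = y ∷ ys} (there x∈ys) with ∈-remove x∈ys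
... | ys′ , len , keep =
  y ∷ ys′ , cong suc len , λ { (here z≡y) _ → here z≡y ; (there z∈ys) z≢x → there (keep z∈ys z≢x) }

unique-⊆⇒length≤ : ∀ {A : Set} {xs ys : List A} → Unique xs → xs ⊆ ys → length xs ≤ length ys
unique-⊆⇒length≤ {xs = []} _ _ = z≤n
unique-⊆⇒length≤ {xs = x ∷ xs} (x∉xs ∷ uniq) xs⊆ys with ∈-remove (xs⊆ys (here refl))
... | ys′ , len , keep = subst (suc (length xs) ≤_) (sym len)
  (s≤s (unique-⊆⇒length≤ uniq λ z∈xs →
    keep (xs⊆ys (there z∈xs)) (λ z≡x → All.lookup x∉xs z∈xs (sym z≡x))))

rank-injective : (p : Pref n) {x y : Fin n} → p ⟨$⟩ʳ x ≡ p ⟨$⟩ʳ y → x ≡ y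
rank-injective p e = trans (sym (inverseˡ p)) (Inverse.inverseʳ p e)

≺-irrefl : (p : Pref n) {x : Fin n} → ¬ (x ≺[ p ] x)
≺-irrefl p = <-irrefl refl

≺⇒≢ : (p : Pref n) {x y : Fin n} → x ≺[ p ] y → x ≢ y
≺⇒≢ p x≺y refl = ≺-irrefl p x≺y

⊀⇒≺ : (p : Pref n) {x y : Fin n} → x ≢ y → ¬ (y ≺[ p ] x) → x ≺[ p ] y
⊀⇒≺ p {x} {y} x≢y y⊀x with <-cmp (p ⟨$⟩ʳ x) (p ⟨$⟩ʳ y)
... | tri< x≺y _ _ = x≺y
... | tri≈ _ e _   = contradiction (rank-injective p e) x≢y
... | tri> _ _ y≺x = contradiction y≺x y⊀x

IsTop⇒minimal : (p : Pref n) {S : Subset n} {x y : Fin n} → IsTop p S x → y ∈ S → ¬ (y ≺[ p ] x)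
IsTop⇒minimal p (_ , top) y∈S y≺x with top _ y∈S
... | inj₁ refl = ≺-irrefl p y≺x
... | inj₂ x≺y  = <-asym x≺y y≺x

rankFirst : Fin n → Pref n
rankFirst {suc _} a = transpose a zero

rankFirst-rank : (a : Fin (suc n)) → rankFirst a ⟨$⟩ʳ a ≡ zero
rankFirst-rank a rewrite dec-true (a ≟ a) refl = refl

rankFirst-first : (a x : Fin n) → x ≢ a → a ≺[ rankFirst a ] x
rankFirst-first {suc _} a x x≢a rewrite rankFirst-rank a with rankFirst a ⟨$⟩ʳ x in rank-x
... | zero  = contradiction (rank-injective (rankFirst a) (trans rank-x (sym (rankFirst-rank a)))) x≢a
... | suc _ = z<s

module _ {P : Pred (Fin n) 0ℓ} (P? : Decidable P) where

  subsetOf : Subset n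
  subsetOf = tabulate (does ∘ P?)

  ∈-subsetOf⁺ : ∀ {a} → P a → a ∈ subsetOf
  ∈-subsetOf⁺ {a} pa = lookup⇒[]= a _ (trans (lookup∘tabulate _ a) (dec-true (P? a) pa))

  ∈-subsetOf⁻ : ∀ {a} → a ∈ subsetOf → P a
  ∈-subsetOf⁻ {a} a∈ with P? a | trans (sym (lookup∘tabulate _ a)) ([]=⇒lookup a∈)
  ... | yes pa | _ = pa
  ... | no _   | ()

WeaklyPrefersToPartner : Profile n → Matching n → Fin n → Fin n → Set
WeaklyPrefersToPartner pA M b a = b ≡ M ⟨$⟩ʳ a ⊎ b ≺[ pA a ] (M ⟨$⟩ʳ a)

weaklyPrefersToPartner? : (pA : Profile n) (M : Matching n) (b : Fin n) →
                          Decidable (WeaklyPrefersToPartner pA M b)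
weaklyPrefersToPartner? pA M b a = (b ≟ M ⟨$⟩ʳ a) ⊎-dec (pA a ⟨$⟩ʳ b <? pA a ⟨$⟩ʳ (M ⟨$⟩ʳ a))

querySet : Profile n → Matching n → Fin n → Subset n
querySet pA M b = subsetOf (weaklyPrefersToPartner? pA M b)

≺partner⇒partner≢ : (pA : Profile n) (M : Matching n) {a b : Fin n} →
                    b ≺[ pA a ] (M ⟨$⟩ʳ a) → M ⟨$⟩ˡ b ≢ a
≺partner⇒partner≢ pA M {a} b≺Ma Mb≡a = ≺⇒≢ (pA a) b≺Ma (sym (Inverse.inverseˡ M (sym Mb≡a)))

partner-isTop : (pA pB : Profile n) (M : Matching n) → Stable pA pB M →
                ∀ b → IsTop (pB b) (querySet pA M b) (M ⟨$⟩ˡ b)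
partner-isTop pA pB M stable b =
  ∈-subsetOf⁺ (weaklyPrefersToPartner? pA M b) (inj₁ (sym (inverseʳ M))) , above
  where
  above : ∀ a → a ∈ querySet pA M b → a ≡ M ⟨$⟩ˡ b ⊎ (M ⟨$⟩ˡ b) ≺[ pB b ] a
  above a a∈S with ∈-subsetOf⁻ (weaklyPrefersToPartner? pA M b) a∈S
  ... | inj₁ b≡Ma = inj₁ (sym (Inverse.inverseʳ M b≡Ma))
  ... | inj₂ b≺Ma = inj₂ (⊀⇒≺ (pB b) (≺partner⇒partner≢ pA M b≺Ma)
                               (λ a≺Mb → stable a b (≺⇒≢ (pA a) b≺Ma) (b≺Ma , a≺Mb)))

partners-isTop⇒stable : (pA pB : Profile n) (M : Matching n) →
                         (∀ b → Cand pA M b → IsTop (pB b) (querySet pA M b) (M ⟨$⟩ˡ b)) → Stable pA pB M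
partners-isTop⇒stable pA pB M top a b _ (b≺Ma , a≺Mb) =
  IsTop⇒minimal (pB b) (top b (a , b≺Ma)) (∈-subsetOf⁺ (weaklyPrefersToPartner? pA M b) (inj₂ b≺Ma)) a≺Mb

candidates : Profile n → Matching n → List (Fin n)
candidates pA M = filter (cand? pA M) (allFin _)

partnerQuery : Profile n → Matching n → Fin n → Query n × Fin n
partnerQuery pA M b = (b , querySet pA M b) , M ⟨$⟩ˡ b

certificate : Profile n → Matching n → List (Query n × Fin n)
certificate pA M = map (partnerQuery pA M) (candidates pA M)

length-certificate : (pA : Profile n) (M : Matching n) → length (certificate pA M) ≡ candCount pA M
length-certificate pA M = length-map (partnerQuery pA M) (candidates pA M)

certificate-answered : (pA pB : Profile n) (M : Matching n) → Stable pA pB M →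
                       All (uncurry (Answers pB)) (certificate pA M)
certificate-answered pA pB M stable = map⁺ (universal (partner-isTop pA pB M stable) (candidates pA M))

certificate-verifies : (pA pB : Profile n) (M : Matching n) → Stable pA pB M →
                       Verifies pA M pB (queriesOf (certificate pA M))
certificate-verifies pA pB M stable pB′ consistent = partners-isTop⇒stable pA pB′ M top
  where
  top : ∀ b → Cand pA M b → IsTop (pB′ b) (querySet pA M b) (M ⟨$⟩ˡ b)
  top b cand = All.lookup consistent asked (M ⟨$⟩ˡ b) (partner-isTop pA pB M stable b)
    where
    asked : (b , querySet pA M b) ∈ₗ queriesOf (certificate pA M)
    asked = ∈-map⁺ proj₁ (∈-map⁺ (partnerQuery pA M) (∈-filter⁺ (cand? pA M) (∈-allFin b) cand))

consistent-updateAt : (pB : Profile n) (b : Fin n) (p : Pref n) (Q : List (Query n)) →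
                      ¬ (b ∈ₗ map proj₁ Q) → Consistent pB (updateAt pB b (const p)) Q
consistent-updateAt pB b p Q b∉Q = All.map unchanged (map⁻ (¬Any⇒All¬ _ b∉Q))
  where
  unchanged : ∀ {q} → b ≢ proj₁ q → ∀ a → Answers pB q a → Answers (updateAt pB b (const p)) q a
  unchanged {c , S} b≢c a = subst (λ r → IsTop r S a) (sym (updateAt-minimal c b pB (b≢c ∘ sym)))

candidate-queried : (pA pB : Profile n) (M : Matching n) (Q : List (Query n)) →
                    Verifies pA M pB Q → ∀ {b} → Cand pA M b → b ∈ₗ map proj₁ Q
candidate-queried {n} pA pB M Q verifies {b} (a , b≺Ma) with any? (b ≟_) (map proj₁ Q)
... | yes b∈Q = b∈Q
... | no b∉Q  = ⊥-elim (stable′ a b (≺⇒≢ (pA a) b≺Ma) (b≺Ma , a≺Mb))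
  where
  pB′ : Profile n
  pB′ = updateAt pB b (const (rankFirst a))
  stable′ : Stable pA pB′ M
  stable′ = verifies pB′ (consistent-updateAt pB b (rankFirst a) Q b∉Q)
  a≺Mb : a ≺[ pB′ b ] (M ⟨$⟩ˡ b)
  a≺Mb rewrite updateAt-updates b {const (rankFirst a)} pB =
    rankFirst-first a (M ⟨$⟩ˡ b) (≺partner⇒partner≢ pA M b≺Ma)

candCount≤queries : (pA pB : Profile n) (M : Matching n) (Q : List (Query n)) →
                    Verifies pA M pB Q → candCount pA M ≤ length Q
candCount≤queries {n} pA pB M Q verifies = ≤-trans
  (unique-⊆⇒length≤ (filter⁺ (cand? pA M) (allFin⁺ n))
                     (candidate-queried pA pB M Q verifies ∘ proj₂ ∘ ∈-filter⁻ (cand? pA M) {xs = allFin n}))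
  (≤-reflexive (length-map proj₁ Q))

candCount≤n : (pA : Profile n) (M : Matching n) → candCount pA M ≤ n
candCount≤n {n} pA M =
  ≤-trans (length-filter (cand? pA M) (allFin n)) (≤-reflexive (length-tabulate id))

drop-length-map-++ : ∀ {A B : Set} (f : A → B) (xs ys : List A) →
                     drop (length xs) (map f (xs ++ ys)) ≡ map f ys
drop-length-map-++ f []       ys = refl
drop-length-map-++ f (x ∷ xs) ys = drop-length-map-++ f xs ys

followScript : (∀ {n} → Profile n → Matching n → List (Query n)) → Algorithm
followScript script pA M h = head (drop (length h) (script pA M))

module _ (script : ∀ {n} → Profile n → Matching n → List (Query n))
         (pA : Profile n) (M : Matching n) (pB : Profile n) where

  private
    Reach : List (Query n × Fin n) → Set
    Reach = Reachable (followScript script) pA M pB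

  followScript-reaches : ∀ pre rest → queriesOf (pre ++ rest) ≡ script pA M →
                         All (uncurry (Answers pB)) rest → Reach pre → Reach (pre ++ rest)
  followScript-reaches pre []         _      _          r = subst Reach (sym (++-identityʳ pre)) r
  followScript-reaches pre (x ∷ rest) script≡ (ax ∷ axs) r =
    subst Reach (++-assoc pre [ x ] rest)
      (followScript-reaches (pre ∷ʳ x) rest (trans (cong queriesOf (++-assoc pre [ x ] rest)) script≡) axs
                            (step r next ax))
    where
    next : followScript script pA M pre ≡ just (proj₁ x)
    next = cong head (trans (cong (drop (length pre)) (sym script≡))
                            (drop-length-map-++ proj₁ pre (x ∷ rest)))

  followScript-terminates : ∀ h → queriesOf h ≡ script pA M → All (uncurry (Answers pB)) h →
                            Terminates (followScript script) pA M pB h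
  followScript-terminates h script≡ answered =
      followScript-reaches [] h script≡ answered start
    , cong head (trans (cong (drop (length h)) (sym script≡))
                       (drop-all (length h) (map proj₁ h) (≤-reflexive (length-map proj₁ h))))

verifier : Algorithm
verifier = followScript (λ pA M → queriesOf (certificate pA M))

theorem21 : (∀ (n : ℕ) (pA : Profile n) (M : Matching n) (pB : Profile n) →
               Stable pA pB M →
               (∃ λ (Q : List (Query n)) → Verifies pA M pB Q × length Q ≡ candCount pA M)
               × (∀ (Q : List (Query n)) → Verifies pA M pB Q → candCount pA M ≤ length Q)
               × candCount pA M ≤ n)
            × (∃ λ (alg : Algorithm) →
                 ∀ (n : ℕ) (pA : Profile n) (M : Matching n) (pB : Profile n) →
                 Stable pA pB M →
                 ∃ λ h → Terminates alg pA M pB h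
                         × Verifies pA M pB (queriesOf h)
                         × (∀ (Q : List (Query n)) → Verifies pA M pB Q →
                              length h ≤ length Q))
theorem21 =
    (λ n pA M pB stable →
        ( queriesOf (certificate pA M)
        , certificate-verifies pA pB M stable
        , trans (length-map proj₁ (certificate pA M)) (length-certificate pA M))
      , candCount≤queries pA pB M
      , candCount≤n pA M)
  , verifier
  , λ n pA M pB stable →
        certificate pA M
      , followScript-terminates _ pA M pB (certificate pA M) refl (certificate-answered pA pB M stable)
      , certificate-verifies pA pB M stable
      , λ Q verifies → ≤-trans (≤-reflexive (length-certificate pA M)) (candCount≤queries pA pB M Q verifies)
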